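{- Let $(G,\tau)$ be an instance of RFTT and let $\tau'$ be obtained by rounding every turnover time $\tau_j$ down to a power of $2$ (i.e. $\tau'_j=2^{\lfloor\log_2\tau_j\rfloor}$). Then $OPT(G,\tau')\le 2\,OPT(G,\tau)$, both for the \textsc{min-avg} and for the \textsc{min-max} objective.
   Context: RFTT: an instance is $(G,\tau)$ with $G=(V\cup\{s\},E,c)$ a connected graph with depot $s$, nonnegative edge weights $c$, clients $V=\{v_1,\dots,v_n\}$ and turnover times $\tau\in\mathbb{N}^n$. A solution gives for each day $k\ge1$ a closed walk $T_k$ in $G$ from $s$ back to $s$ and a set $J_k\subseteq V$ of clients on $T_k$ visited that day; it is feasible if for all $t\ge0$ and all $j$, $v_j\in\bigcup_{k=t+1}^{t+\tau_j}J_k$; solutions are periodic with some period $\ell$. Tour length $c(T_k)$ is the total edge weight with multiplicity. The \textsc{min-avg} objective is $\frac1\ell\sum_{k=1}^\ell c(T_k)$ and the \textsc{min-max} objective is $\max_k c(T_k)$. $OPT(G,\tau)$ denotes the optimal (minimum) objective value over feasible solutions for the objective under consideration.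
   Formalization: The edge weights c take values in the nonnegative rationals instead of the nonnegative reals. -}

module Defs where

open import Data.Nat using (ℕ; zero; suc; _+_; _∸_; _^_) renaming (_≤_ to _≤ℕ_)
open import Data.Nat.DivMod using (_mod_)
open import Data.Nat.Logarithm using (⌊log₂_⌋)
open import Data.Fin using (Fin; zero; suc)
open import Data.Fin.Subset using (Subset) renaming (_∈_ to _∈ₛ_)
open import Data.Integer using (+_)
open import Data.Rational using (ℚ; 0ℚ; _≤_; _*_; _⊔_; _/_) renaming (_+_ to _+ℚ_)
open import Data.List using (List; []; _∷_)
open import Data.List.Membership.Propositional using (_∈_)
open import Data.Product using (Σ; ∃; _×_; _,_)
open import Data.Sum using (_⊎_)
open import Relation.Binary.PropositionalEquality using (_≡_)

-- A weighted (multi)graph on vertex set Fin (suc n):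
-- vertex 'zero' is the depot s, vertex 'suc j' is client v_j (j : Fin n).
record Graph (n : ℕ) : Set where
  field
    m      : ℕ
    src    : Fin m → Fin (suc n)
    dst    : Fin m → Fin (suc n)
    c      : Fin m → ℚ
    c≥0    : ∀ e → 0ℚ ≤ c e

open Graph public

depot : ∀ {n} → Fin (suc n)
depot = zero

client : ∀ {n} → Fin n → Fin (suc n)
client j = suc j

Step : ∀ {n} (G : Graph n) → Fin (suc n) → Fin (suc n) → Set
Step G x y = Σ (Fin (m G)) λ e →
  (src G e ≡ x × dst G e ≡ y) ⊎ (src G e ≡ y × dst G e ≡ x)

data Walk {n} (G : Graph n) : Fin (suc n) → Fin (suc n) → Set where
  []  : ∀ {x} → Walk G x x
  _∷_ : ∀ {x y z} → Step G x y → Walk G y z → Walk G x z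

vertices : ∀ {n} {G : Graph n} {x y} → Walk G x y → List (Fin (suc n))
vertices {x = x} []      = x ∷ []
vertices {x = x} (_ ∷ w) = x ∷ vertices w

cost : ∀ {n} {G : Graph n} {x y} → Walk G x y → ℚ
cost []                 = 0ℚ
cost {G = G} ((e , _) ∷ w) = c G e +ℚ cost w

Connected : ∀ {n} → Graph n → Set
Connected G = ∀ x y → Walk G x y

-- A periodic solution with period ℓ = suc p: for residue k : Fin ℓ a closed
-- walk tour k from s to s and a set visit k of clients lying on tour k.
-- Day d ≥ 1 uses residue (d ∸ 1) mod ℓ.
record Solution {n} (G : Graph n) : Set where
  field
    p      : ℕ
    tour   : Fin (suc p) → Walk G depot depot
    visit  : Fin (suc p) → Subset n
    onTour : ∀ k j → j ∈ₛ visit k → client j ∈ vertices (tour k)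

open Solution public

period : ∀ {n} {G : Graph n} → Solution G → ℕ
period S = suc (p S)

dayIndex : ∀ {n} {G : Graph n} (S : Solution G) → ℕ → Fin (suc (p S))
dayIndex S d = (d ∸ 1) mod (suc (p S))

Feasible : ∀ {n} {G : Graph n} → (Fin n → ℕ) → Solution G → Set
Feasible {n} τ S = ∀ (t : ℕ) (j : Fin n) → ∃ λ d →
  (suc t ≤ℕ d) × (d ≤ℕ t + τ j) × (j ∈ₛ visit S (dayIndex S d))

sumFin : ∀ {k} → (Fin k → ℚ) → ℚ
sumFin {zero}  f = 0ℚ
sumFin {suc k} f = f zero +ℚ sumFin (λ i → f (suc i))

maxFin : ∀ {k} → (Fin (suc k) → ℚ) → ℚ
maxFin {zero}  f = f zero
maxFin {suc k} f = f zero ⊔ maxFin (λ i → f (suc i))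

avgCost : ∀ {n} {G : Graph n} → Solution G → ℚ
avgCost S = sumFin (λ k → cost (tour S k)) * (+ 1 / suc (p S))

maxCost : ∀ {n} {G : Graph n} → Solution G → ℚ
maxCost S = maxFin (λ k → cost (tour S k))

roundDown : ∀ {n} → (Fin n → ℕ) → Fin n → ℕ
roundDown τ j = 2 ^ ⌊log₂ τ j ⌋

two : ℚ
two = + 2 / 1

module Submission where

-- Proof idea: merge consecutive pairs of days.  From a periodic solution S
-- of period ℓ we build a solution of the same period whose day q+1 follows
-- the tour of day 2q+1 of S and then the tour of day 2q+2, visiting the
-- clients of both.  This only depends on the residue of q mod ℓ, so it is
-- again periodic.  A window of τ′ consecutive merged days contains a window
-- of 2τ′ consecutive original days, so the merged solution is feasible for
-- every τ′ with τ ≤ 2τ′.  Each merged tour costs at most twice the longest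
-- original tour, and days 1 … 2ℓ of S are two full periods, so the total
-- cost per period exactly doubles.  Finally τ ≤ 2 · 2^⌊log₂ τ⌋.

open import Defs
open import Data.Nat using (ℕ) renaming (_≤_ to _≤ℕ_)
open import Data.Fin using (Fin)
open import Data.Rational using (_≤_; _*_)
open import Data.Product using (∃; _×_)

open import Data.Nat as ℕ using (zero; suc; _<_; s≤s; _^_; _%_; _/_; NonZero)
import Data.Nat.Properties as ℕP
open import Data.Nat.DivMod
  using (_mod_; m≡m%n+[m/n]*n; m%n<n; [m+n]%n≡m%n; [m+kn]%n≡m%n; m<n⇒m%n≡m;
         m*n/n≡m; /-monoˡ-≤; m<n*o⇒m/o<n)
open import Data.Nat.Logarithm using (⌊log₂_⌋; ⌊log₂⌋-mono-≤; ⌊log₂[2^n]⌋≡n)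
open import Data.Nat.Tactic.RingSolver using (solve-∀)
open import Data.Fin as Fin using (toℕ)
import Data.Fin.Properties as FinP
open import Data.Fin.Subset using (Subset; _∪_) renaming (_∈_ to _∈ₛ_)
open import Data.Fin.Subset.Properties using (x∈p∪q⁻; x∈p∪q⁺)
open import Data.Rational as ℚ using (ℚ; 0ℚ; 1ℚ) renaming (_+_ to _+ℚ_)
import Data.Rational.Properties as ℚP
import Data.Integer as ℤ
open import Data.List.Membership.Propositional using (_∈_)
open import Data.List.Relation.Unary.Any using (here; there)
open import Data.Product using (_,_; proj₁; proj₂)
open import Data.Sum using (inj₁; inj₂)
open import Function using (_∘_)
open import Relation.Binary.PropositionalEquality

-- Rounding down to a power of two loses less than a factor two:
-- if 2^(1+⌊log₂ n⌋) ≤ n, monotonicity of ⌊log₂⌋ would give 1+⌊log₂ n⌋ ≤ ⌊log₂ n⌋.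
n<2^[1+⌊log₂n⌋] : ∀ n → n < 2 ^ suc ⌊log₂ n ⌋
n<2^[1+⌊log₂n⌋] n = ℕP.≰⇒> λ 2^[1+L]≤n →
  ℕP.<-irrefl refl (ℕP.≤-trans
    (ℕP.≤-reflexive (sym (⌊log₂[2^n]⌋≡n (suc ⌊log₂ n ⌋))))
    (⌊log₂⌋-mono-≤ 2^[1+L]≤n))

-- The day e+1 of a window of length 2M starting after day 2t corresponds to
-- merged day ⌊e/2⌋+1, which lies in the window of length M starting after t.
halve-window : ∀ t {e} M → t ℕ.* 2 ≤ℕ e → e < M ℕ.* 2 → t ≤ℕ e / 2 × e / 2 < M
halve-window t M 2t≤e e<2M =
  subst (_≤ℕ _) (m*n/n≡m t 2) (/-monoˡ-≤ 2 2t≤e) , m<n*o⇒m/o<n e<2M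

mod-cong : ∀ ℓ .{{_ : NonZero ℓ}} x y → x % ℓ ≡ y % ℓ → x mod ℓ ≡ y mod ℓ
mod-cong ℓ x y eq = FinP.fromℕ<-cong _ _ eq _ _

toℕ-mod : ∀ {ℓ} .{{_ : NonZero ℓ}} (k : Fin ℓ) → toℕ k mod ℓ ≡ k
toℕ-mod {ℓ} k =
  trans (FinP.fromℕ<-cong _ _ (m<n⇒m%n≡m k<ℓ) _ k<ℓ) (FinP.fromℕ<-toℕ k k<ℓ)
  where k<ℓ = FinP.toℕ<n k

mod-affine : ∀ ℓ .{{_ : NonZero ℓ}} b c q →
  (b ℕ.+ toℕ (q mod ℓ) ℕ.* c) mod ℓ ≡ (b ℕ.+ q ℕ.* c) mod ℓ
mod-affine ℓ b c q = mod-cong ℓ _ _ (begin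
    (b ℕ.+ toℕ (q mod ℓ) ℕ.* c) % ℓ
      ≡⟨ cong (λ r → (b ℕ.+ r ℕ.* c) % ℓ) (FinP.toℕ-fromℕ< (m%n<n q ℓ)) ⟩
    (b ℕ.+ q % ℓ ℕ.* c) % ℓ
      ≡⟨ sym ([m+kn]%n≡m%n (b ℕ.+ q % ℓ ℕ.* c) (q / ℓ ℕ.* c) ℓ) ⟩
    (b ℕ.+ q % ℓ ℕ.* c ℕ.+ q / ℓ ℕ.* c ℕ.* ℓ) % ℓ
      ≡⟨ cong (_% ℓ) (regroup b (q % ℓ) (q / ℓ) c ℓ) ⟩
    (b ℕ.+ (q % ℓ ℕ.+ q / ℓ ℕ.* ℓ) ℕ.* c) % ℓ
      ≡⟨ cong (λ x → (b ℕ.+ x ℕ.* c) % ℓ) (sym (m≡m%n+[m/n]*n q ℓ)) ⟩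
    (b ℕ.+ q ℕ.* c) % ℓ ∎)
  where
  open ≡-Reasoning
  regroup : ∀ b r s c ℓ → b ℕ.+ r ℕ.* c ℕ.+ s ℕ.* c ℕ.* ℓ ≡ b ℕ.+ (r ℕ.+ s ℕ.* ℓ) ℕ.* c
  regroup = solve-∀

module _ {n} {G : Graph n} where

  infixr 5 _++ʷ_
  _++ʷ_ : ∀ {x y z} → Walk G x y → Walk G y z → Walk G x z
  []      ++ʷ v = v
  (s ∷ w) ++ʷ v = s ∷ (w ++ʷ v)

  start∈vertices : ∀ {x y} (w : Walk G x y) → x ∈ vertices w
  start∈vertices []      = here refl
  start∈vertices (_ ∷ _) = here refl

  ∈-++ʷˡ : ∀ {x y z a} (w : Walk G x y) (v : Walk G y z) →
    a ∈ vertices w → a ∈ vertices (w ++ʷ v)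
  ∈-++ʷˡ []      v (here refl) = start∈vertices v
  ∈-++ʷˡ (s ∷ w) v (here a≡x)  = here a≡x
  ∈-++ʷˡ (s ∷ w) v (there a∈w) = there (∈-++ʷˡ w v a∈w)

  ∈-++ʷʳ : ∀ {x y z a} (w : Walk G x y) (v : Walk G y z) →
    a ∈ vertices v → a ∈ vertices (w ++ʷ v)
  ∈-++ʷʳ []      v a∈v = a∈v
  ∈-++ʷʳ (s ∷ w) v a∈v = there (∈-++ʷʳ w v a∈v)

  cost-++ʷ : ∀ {x y z} (w : Walk G x y) (v : Walk G y z) →
    cost (w ++ʷ v) ≡ cost w +ℚ cost v
  cost-++ʷ []            v = sym (ℚP.+-identityˡ (cost v))
  cost-++ʷ ((e , _) ∷ w) v =
    trans (cong (c G e +ℚ_) (cost-++ʷ w v)) (sym (ℚP.+-assoc (c G e) (cost w) (cost v)))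

-- Finite sums over ℚ.  sumℕ k h = h 0 + … + h (k-1) reindexes sums over Fin k
-- by natural numbers, where splitting and regrouping are easy.
sumℕ : ℕ → (ℕ → ℚ) → ℚ
sumℕ zero    h = 0ℚ
sumℕ (suc k) h = h 0 +ℚ sumℕ k (h ∘ suc)

sumℕ-cong : ∀ k {h h′ : ℕ → ℚ} → (∀ i → h i ≡ h′ i) → sumℕ k h ≡ sumℕ k h′
sumℕ-cong zero    eq = refl
sumℕ-cong (suc k) eq = cong₂ _+ℚ_ (eq 0) (sumℕ-cong k (eq ∘ suc))

sumFin-cong : ∀ {k} {f f′ : Fin k → ℚ} → (∀ i → f i ≡ f′ i) → sumFin f ≡ sumFin f′
sumFin-cong {zero}  eq = refl
sumFin-cong {suc k} eq = cong₂ _+ℚ_ (eq Fin.zero) (sumFin-cong (eq ∘ Fin.suc))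

sumFin-toℕ : ∀ k (h : ℕ → ℚ) → sumFin {k} (h ∘ toℕ) ≡ sumℕ k h
sumFin-toℕ zero    h = refl
sumFin-toℕ (suc k) h = cong (h 0 +ℚ_) (sumFin-toℕ k (h ∘ suc))

sumℕ-+ : ∀ a b (h : ℕ → ℚ) → sumℕ (a ℕ.+ b) h ≡ sumℕ a h +ℚ sumℕ b (λ i → h (a ℕ.+ i))
sumℕ-+ zero    b h = sym (ℚP.+-identityˡ _)
sumℕ-+ (suc a) b h =
  trans (cong (h 0 +ℚ_) (sumℕ-+ a b (h ∘ suc))) (sym (ℚP.+-assoc (h 0) _ _))

sumℕ-pairs : ∀ k (h : ℕ → ℚ) →
  sumℕ (k ℕ.* 2) h ≡ sumℕ k (λ i → h (i ℕ.* 2) +ℚ h (1 ℕ.+ i ℕ.* 2))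
sumℕ-pairs zero    h = refl
sumℕ-pairs (suc k) h =
  trans (cong (λ s → h 0 +ℚ (h 1 +ℚ s)) (sumℕ-pairs k (h ∘ suc ∘ suc)))
        (sym (ℚP.+-assoc (h 0) (h 1) _))

sumℕ-two-periods : ∀ ℓ (h : ℕ → ℚ) → (∀ i → h (ℓ ℕ.+ i) ≡ h i) →
  sumℕ (ℓ ℕ.* 2) h ≡ sumℕ ℓ h +ℚ sumℕ ℓ h
sumℕ-two-periods ℓ h periodic = begin
  sumℕ (ℓ ℕ.* 2) h                         ≡⟨ cong (λ m → sumℕ m h) (ℓ*2≡ℓ+ℓ ℓ) ⟩
  sumℕ (ℓ ℕ.+ ℓ) h                         ≡⟨ sumℕ-+ ℓ ℓ h ⟩
  sumℕ ℓ h +ℚ sumℕ ℓ (λ i → h (ℓ ℕ.+ i))   ≡⟨ cong (sumℕ ℓ h +ℚ_) (sumℕ-cong ℓ periodic) ⟩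
  sumℕ ℓ h +ℚ sumℕ ℓ h                     ∎
  where
  open ≡-Reasoning
  ℓ*2≡ℓ+ℓ : ∀ ℓ → ℓ ℕ.* 2 ≡ ℓ ℕ.+ ℓ
  ℓ*2≡ℓ+ℓ = solve-∀

two*≡+ : ∀ y → two * y ≡ y +ℚ y
two*≡+ y = trans (ℚP.*-distribʳ-+ y 1ℚ 1ℚ) (cong₂ _+ℚ_ (ℚP.*-identityˡ y) (ℚP.*-identityˡ y))

≤-maxFin : ∀ {k} (f : Fin (suc k) → ℚ) i → f i ≤ maxFin f
≤-maxFin {zero}  f Fin.zero    = ℚP.≤-refl
≤-maxFin {suc k} f Fin.zero    = ℚP.p≤p⊔q (f Fin.zero) _
≤-maxFin {suc k} f (Fin.suc i) =
  ℚP.≤-trans (≤-maxFin (f ∘ Fin.suc) i) (ℚP.p≤q⊔p (f Fin.zero) _)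

maxFin-lub : ∀ {k} (f : Fin (suc k) → ℚ) {M} → (∀ i → f i ≤ M) → maxFin f ≤ M
maxFin-lub {zero}  f f≤M = f≤M Fin.zero
maxFin-lub {suc k} f f≤M = ℚP.⊔-lub (f≤M Fin.zero) (maxFin-lub (f ∘ Fin.suc) (f≤M ∘ Fin.suc))

-- The merged residue k runs the original residues 2k and 2k+1 (mod ℓ), so
-- merged day q+1 covers the original days 2q+1 and 2q+2.
module Merge {n} {G : Graph n} (S : Solution G) where

  ℓ : ℕ
  ℓ = period S

  half : ℕ → Fin ℓ → Fin ℓ
  half b k = (b ℕ.+ toℕ k ℕ.* 2) mod ℓ

  mergedTour : Fin ℓ → Walk G depot depot
  mergedTour k = tour S (half 0 k) ++ʷ tour S (half 1 k)

  mergedVisit : Fin ℓ → Subset n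
  mergedVisit k = visit S (half 0 k) ∪ visit S (half 1 k)

  visits-on-mergedTour : ∀ k j → j ∈ₛ mergedVisit k → client j ∈ vertices (mergedTour k)
  visits-on-mergedTour k j j∈ with x∈p∪q⁻ (visit S (half 0 k)) (visit S (half 1 k)) j∈
  ... | inj₁ j∈₀ = ∈-++ʷˡ (tour S (half 0 k)) (tour S (half 1 k)) (onTour S (half 0 k) j j∈₀)
  ... | inj₂ j∈₁ = ∈-++ʷʳ (tour S (half 0 k)) (tour S (half 1 k)) (onTour S (half 1 k) j j∈₁)

  merged : Solution G
  merged = record
    { p = p S ; tour = mergedTour ; visit = mergedVisit ; onTour = visits-on-mergedTour }

  half-visited : ∀ {j} b q → b < 2 →
    j ∈ₛ visit S ((b ℕ.+ q ℕ.* 2) mod ℓ) → j ∈ₛ mergedVisit (q mod ℓ)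
  half-visited {j} 0 q _ j∈ =
    x∈p∪q⁺ (inj₁ (subst (λ r → j ∈ₛ visit S r) (sym (mod-affine ℓ 0 2 q)) j∈))
  half-visited {j} 1 q _ j∈ =
    x∈p∪q⁺ (inj₂ (subst (λ r → j ∈ₛ visit S r) (sym (mod-affine ℓ 1 2 q)) j∈))
  half-visited (suc (suc _)) _ (s≤s (s≤s ())) _

  day-visited : ∀ {j} e → j ∈ₛ visit S (e mod ℓ) → j ∈ₛ mergedVisit ((e / 2) mod ℓ)
  day-visited {j} e j∈ = half-visited (e % 2) (e / 2) (m%n<n e 2)
    (subst (λ x → j ∈ₛ visit S (x mod ℓ)) (m≡m%n+[m/n]*n e 2) j∈)

  merged-feasible : ∀ {τ τ′ : Fin n → ℕ} → (∀ j → τ j ≤ℕ τ′ j ℕ.* 2) →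
    Feasible τ S → Feasible τ′ merged
  merged-feasible {τ} {τ′} τ≤2τ′ feasible t j with feasible (t ℕ.* 2) j
  ... | suc e , s≤s 2t≤e , e<2t+τ , j∈ =
    suc (e / 2) , s≤s (proj₁ halved) , proj₂ halved , day-visited e j∈
    where
    e<2[t+τ′] : e < (t ℕ.+ τ′ j) ℕ.* 2
    e<2[t+τ′] = ℕP.≤-trans e<2t+τ (ℕP.≤-trans (ℕP.+-monoʳ-≤ (t ℕ.* 2) (τ≤2τ′ j))
                  (ℕP.≤-reflexive (sym (ℕP.*-distribʳ-+ 2 t (τ′ j)))))
    halved : t ≤ℕ e / 2 × e / 2 < t ℕ.+ τ′ j
    halved = halve-window t (t ℕ.+ τ′ j) 2t≤e e<2[t+τ′]

  tourCost : Fin ℓ → ℚ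
  tourCost k = cost (tour S k)

  dayCost : ℕ → ℚ
  dayCost i = tourCost (i mod ℓ)

  mergedTourCost : ∀ k → cost (mergedTour k) ≡ dayCost (toℕ k ℕ.* 2) +ℚ dayCost (1 ℕ.+ toℕ k ℕ.* 2)
  mergedTourCost k = cost-++ʷ (tour S (half 0 k)) (tour S (half 1 k))

  period-cost : sumℕ ℓ dayCost ≡ sumFin tourCost
  period-cost = trans (sym (sumFin-toℕ ℓ dayCost)) (sumFin-cong {ℓ} (cong tourCost ∘ toℕ-mod))

  dayCost-periodic : ∀ i → dayCost (ℓ ℕ.+ i) ≡ dayCost i
  dayCost-periodic i =
    cong tourCost (mod-cong ℓ (ℓ ℕ.+ i) i (trans (cong (_% ℓ) (ℕP.+-comm ℓ i)) ([m+n]%n≡m%n i ℓ)))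

  -- one merged period covers two original periods, so its total cost doubles
  merged-total-cost : sumFin (cost ∘ mergedTour) ≡ sumFin tourCost +ℚ sumFin tourCost
  merged-total-cost = begin
    sumFin (cost ∘ mergedTour)
      ≡⟨ sumFin-cong {ℓ} mergedTourCost ⟩
    sumFin {ℓ} (λ k → dayCost (toℕ k ℕ.* 2) +ℚ dayCost (1 ℕ.+ toℕ k ℕ.* 2))
      ≡⟨ sumFin-toℕ ℓ (λ i → dayCost (i ℕ.* 2) +ℚ dayCost (1 ℕ.+ i ℕ.* 2)) ⟩
    sumℕ ℓ (λ i → dayCost (i ℕ.* 2) +ℚ dayCost (1 ℕ.+ i ℕ.* 2))
      ≡⟨ sym (sumℕ-pairs ℓ dayCost) ⟩
    sumℕ (ℓ ℕ.* 2) dayCost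
      ≡⟨ sumℕ-two-periods ℓ dayCost dayCost-periodic ⟩
    sumℕ ℓ dayCost +ℚ sumℕ ℓ dayCost
      ≡⟨ cong₂ _+ℚ_ period-cost period-cost ⟩
    sumFin tourCost +ℚ sumFin tourCost ∎
    where open ≡-Reasoning

  merged-avgCost : avgCost merged ≤ two * avgCost S
  merged-avgCost = ℚP.≤-reflexive (begin
    sumFin (cost ∘ mergedTour) * 1/ℓ          ≡⟨ cong (_* 1/ℓ) merged-total-cost ⟩
    (sumFin tourCost +ℚ sumFin tourCost) * 1/ℓ ≡⟨ cong (_* 1/ℓ) (sym (two*≡+ (sumFin tourCost))) ⟩
    (two * sumFin tourCost) * 1/ℓ              ≡⟨ ℚP.*-assoc two (sumFin tourCost) 1/ℓ ⟩
    two * (sumFin tourCost * 1/ℓ)              ∎)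
    where
    open ≡-Reasoning
    1/ℓ : ℚ
    1/ℓ = ℤ.+ 1 ℚ./ ℓ

  merged-maxCost : maxCost merged ≤ two * maxCost S
  merged-maxCost = maxFin-lub (cost ∘ mergedTour) λ k → begin
    cost (mergedTour k)                            ≡⟨ mergedTourCost k ⟩
    dayCost (toℕ k ℕ.* 2) +ℚ dayCost (1 ℕ.+ toℕ k ℕ.* 2)
      ≤⟨ ℚP.+-mono-≤ (≤-maxFin tourCost _) (≤-maxFin tourCost _) ⟩
    maxCost S +ℚ maxCost S                        ≡⟨ sym (two*≡+ (maxCost S)) ⟩
    two * maxCost S                                ∎
    where open ℚP.≤-Reasoning

lemma1 : ∀ {n} (G : Graph n) → Connected G → (τ : Fin n → ℕ) → (∀ j → 1 ≤ℕ τ j) →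
    ((S : Solution G) → Feasible τ S →
      ∃ λ (S′ : Solution G) → Feasible (roundDown τ) S′ × avgCost S′ ≤ two * avgCost S)
    ×
    ((S : Solution G) → Feasible τ S →
      ∃ λ (S′ : Solution G) → Feasible (roundDown τ) S′ × maxCost S′ ≤ two * maxCost S)
lemma1 G _ τ _ =
  (λ S feasible → merged S , merged-feasible S τ≤2τ′ feasible , merged-avgCost S) ,
  (λ S feasible → merged S , merged-feasible S τ≤2τ′ feasible , merged-maxCost S)
  where
  open Merge using (merged; merged-feasible; merged-avgCost; merged-maxCost)
  τ≤2τ′ : ∀ j → τ j ≤ℕ roundDown τ j ℕ.* 2
  τ≤2τ′ j = ℕP.≤-trans (ℕP.<⇒≤ (n<2^[1+⌊log₂n⌋] (τ j))) (ℕP.≤-reflexive (ℕP.*-comm 2 (roundDown τ j)))
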